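{- For every integer $n \ge 5$, $\mathrm{eqdim}(K_{n,2}) = 3$.
   Context: For positive integers $n$ and $k$, the Kneser graph $K_{n,k}$ has as vertices all $k$-element subsets of $\{1,\dots,n\}$, two such subsets $A,B$ being adjacent iff $A \cap B = \emptyset$. In a connected graph $G$, $d(u,v)$ is the shortest-path distance. A subset $S \subseteq V(G)$ is a distance-equalizer set of $G$ if for every two distinct vertices $u,v \in V(G)\setminus S$ there exists $x \in S$ with $d(u,x) = d(v,x)$. The equidistant dimension $\mathrm{eqdim}(G)$ is the minimum cardinality of a distance-equalizer set of $G$. -}

module Defs where

open import Level using (Level; _⊔_)
open import Data.Nat using (ℕ; zero; suc; _≤_)
open import Data.Product using (Σ; ∃; _×_; _,_; proj₁)
open import Data.List using (List; length)
open import Data.List.Membership.Propositional using (_∈_)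
open import Data.List.Relation.Unary.Unique.Propositional using (Unique)
open import Data.Fin.Subset using (Subset; _∩_; ⊥; ∣_∣)
open import Relation.Binary.PropositionalEquality using (_≡_; _≢_)
open import Relation.Nullary using (¬_)

record Graph (a ℓ : Level) : Set (Level.suc (a ⊔ ℓ)) where
  field
    V   : Set a
    Adj : V → V → Set ℓ

module _ {a ℓ} (G : Graph a ℓ) where
  open Graph G

  data Walk : V → V → ℕ → Set (a ⊔ ℓ) where
    here : ∀ {u} → Walk u u zero
    step : ∀ {u w v k} → Adj u w → Walk w v k → Walk u v (suc k)

  Dist : V → V → ℕ → Set (a ⊔ ℓ)
  Dist u v k = Walk u v k × (∀ m → Walk u v m → k ≤ m)

  Connected : Set (a ⊔ ℓ)
  Connected = ∀ u v → ∃ λ k → Dist u v k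

  IsDistanceEqualizer : List V → Set (a ⊔ ℓ)
  IsDistanceEqualizer S =
    ∀ u v → u ≢ v → ¬ (u ∈ S) → ¬ (v ∈ S) →
    ∃ λ x → x ∈ S × ∃ λ k → Dist u x k × Dist v x k

  -- eqdim G = m : m is the minimum cardinality of a distance-equalizer set
  -- (finite sets of vertices are represented as duplicate-free lists).
  EqDim≡ : ℕ → Set (a ⊔ ℓ)
  EqDim≡ m =
    (∃ λ S → Unique S × length S ≡ m × IsDistanceEqualizer S)
    × (∀ S → Unique S → IsDistanceEqualizer S → m ≤ length S)

Kneser : ℕ → ℕ → Graph Level.zero Level.zero
Kneser n k = record
  { V   = Σ (Subset n) (λ A → ∣ A ∣ ≡ k)
  ; Adj = λ A B → proj₁ A ∩ proj₁ B ≡ ⊥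
  }

{-# OPTIONS --safe #-}
-- In K(n,2) with n ≥ 5, distinct vertices are at distance 1 when disjoint and 2 otherwise:
-- two overlapping pairs cover at most three points, leaving room for a pair disjoint from both.
-- So x is equidistant from u, v ≠ x exactly when x is adjacent to both or to neither.
--
-- Upper bound: take the three sides of a triangle with corners 0, 1, 2. A vertex that is not a
-- side contains at most one corner; with no corner it is adjacent to every side, with corner i
-- it is adjacent only to the side opposite i. Any two such adjacency patterns agree on a side.
--
-- Lower bound: for any x, y there are u, v ∉ {x, y} with each of x, y adjacent to exactly one
-- of u, v. If x, y share a point t, let v be a common neighbour of x and y and u = {t, e} with
-- e ∈ v; if x, y are disjoint, let u = {a, e} and v = {c, e} with a ∈ x, c ∈ y, e ∉ x ∪ y.

module Submission where

open import Defs
open import Level using (_⊔_)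
open import Function using (_∘_; id)
open import Data.Nat using (ℕ; zero; suc; _+_; _≤_; _<_; z≤n; s≤s)
open import Data.Nat.Properties using (≡-irrelevant; ≤-refl; ≤-trans; n≤1+n; m≤m+n; <⇒≱; <-irrefl)
open import Data.Fin using (Fin; zero; suc; inject≤; _≟_)
open import Data.Fin.Patterns using (0F; 1F; 2F)
open import Data.Fin.Properties using (pigeonhole; ¬∀⟶∃¬; <⇒≢; any?; inject≤-injective)
open import Data.Fin.Subset using (Subset; _∩_; _∪_; ⁅_⁆; ∣_∣; Nonempty; _⊆_) renaming (_∈_ to _∈ˢ_; _∉_ to _∉ˢ_; ⊥ to ∅)
open import Data.Fin.Subset.Properties using (_∈?_; nonempty?; ∉⊥; Empty-unique; x∈p∩q⁺; x∈p∩q⁻; x∈p∪q⁺; x∈p∪q⁻; x∈⁅x⁆; x∈⁅y⁆⇒x≡y; x∉⁅y⁆⇒x≢y; ∣⁅x⁆∣≡1; ∣⊥∣≡0; ∪-identityˡ; ∪-identityʳ; ∩-comm; ⊆-antisym; p⊆q⇒∣p∣≤∣q∣; p⊂q⇒∣p∣<∣q∣)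
open import Data.Product using (Σ; ∃; ∃₂; _×_; _,_; proj₁; proj₂; map₂)
open import Data.Sum using (_⊎_; inj₁; inj₂; [_,_])
open import Data.List using (List; []; _∷_; length; lookup; tabulate)
open import Data.List.Relation.Unary.Any using (here; index)
open import Data.List.Relation.Unary.Any.Properties using (lookup-index)
import Data.List.Relation.Unary.Any.Properties as Any
open import Data.List.Relation.Unary.All using (All; []; _∷_)
import Data.List.Relation.Unary.All as All
open import Data.List.Relation.Unary.All.Properties using (¬Any⇒All¬; All¬⇒¬Any; anti-mono)
open import Data.List.Membership.Propositional using (_∈_; _∉_)
open import Data.List.Relation.Binary.Subset.Propositional using () renaming (_⊆_ to _⊆ˡ_)
open import Data.List.Relation.Unary.Unique.Propositional using (Unique)
import Data.List.Relation.Unary.Unique.Propositional.Properties as Unique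
open import Data.Empty using (⊥; ⊥-elim)
open import Relation.Nullary using (¬_; yes; no; contradiction)
open import Relation.Nullary.Decidable using (_×-dec_; ¬?; decidable-stable)
open import Relation.Binary.PropositionalEquality using (_≡_; _≢_; refl; sym; trans; cong; subst; subst₂; ≢-sym)

fresh : ∀ {n} (l : List (Fin n)) → length l < n → ∃ λ e → All (e ≢_) l
fresh {n} l l<n = map₂ (¬Any⇒All¬ l) (¬∀⟶∃¬ n (_∈ l) (_∈ˡ? l) all∈)
  where
  open import Data.List.Membership.DecPropositional (_≟_ {n}) using () renaming (_∈?_ to _∈ˡ?_)
  all∈ : ¬ (∀ e → e ∈ l)
  all∈ ∈l with i , j , i<j , same ← pigeonhole l<n (index ∘ ∈l) =
    <⇒≢ i<j (trans (lookup-index (∈l i)) (trans (cong (lookup l) same) (sym (lookup-index (∈l j)))))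

∣⁅x⁆∪⁅y⁆∣≡2 : ∀ {n} {x y : Fin n} → x ≢ y → ∣ ⁅ x ⁆ ∪ ⁅ y ⁆ ∣ ≡ 2
∣⁅x⁆∪⁅y⁆∣≡2 {x = zero}  {zero}  x≢y = contradiction refl x≢y
∣⁅x⁆∪⁅y⁆∣≡2 {x = zero}  {suc y} _   = cong suc (trans (cong ∣_∣ (∪-identityˡ ⁅ y ⁆)) (∣⁅x⁆∣≡1 y))
∣⁅x⁆∪⁅y⁆∣≡2 {x = suc x} {zero}  _   = cong suc (trans (cong ∣_∣ (∪-identityʳ ⁅ x ⁆)) (∣⁅x⁆∣≡1 x))
∣⁅x⁆∪⁅y⁆∣≡2 {x = suc x} {suc y} x≢y = ∣⁅x⁆∪⁅y⁆∣≡2 (x≢y ∘ cong suc)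

module _ {n : ℕ} {x y : Fin n} where

  x∈⁅x⁆∪⁅y⁆ : x ∈ˢ ⁅ x ⁆ ∪ ⁅ y ⁆
  x∈⁅x⁆∪⁅y⁆ = x∈p∪q⁺ (inj₁ (x∈⁅x⁆ x))

  y∈⁅x⁆∪⁅y⁆ : y ∈ˢ ⁅ x ⁆ ∪ ⁅ y ⁆
  y∈⁅x⁆∪⁅y⁆ = x∈p∪q⁺ (inj₂ (x∈⁅x⁆ y))

  ∈⁅x⁆∪⁅y⁆⁻ : ∀ {t} → t ∈ˢ ⁅ x ⁆ ∪ ⁅ y ⁆ → t ≡ x ⊎ t ≡ y
  ∈⁅x⁆∪⁅y⁆⁻ t∈xy with x∈p∪q⁻ ⁅ x ⁆ ⁅ y ⁆ t∈xy
  ... | inj₁ t∈x = inj₁ (x∈⁅y⁆⇒x≡y x t∈x)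
  ... | inj₂ t∈y = inj₂ (x∈⁅y⁆⇒x≡y y t∈y)

  ∉⁅x⁆∪⁅y⁆ : ∀ {t} → t ≢ x → t ≢ y → t ∉ˢ ⁅ x ⁆ ∪ ⁅ y ⁆
  ∉⁅x⁆∪⁅y⁆ t≢x t≢y t∈xy = [ t≢x , t≢y ] (∈⁅x⁆∪⁅y⁆⁻ t∈xy)

module _ {n : ℕ} where

  outside-member : {p q : Subset n} → ∣ q ∣ < ∣ p ∣ → ∃ λ x → x ∈ˢ p × x ∉ˢ q
  outside-member {p} {q} ∣q∣<∣p∣ with any? (λ x → x ∈? p ×-dec ¬? (x ∈? q))
  ... | yes witness = witness
  ... | no ∄ = contradiction (p⊆q⇒∣p∣≤∣q∣ p⊆q) (<⇒≱ ∣q∣<∣p∣)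
    where
    p⊆q : p ⊆ q
    p⊆q {x} x∈p = decidable-stable (x ∈? q) (λ x∉q → ∄ (x , x∈p , x∉q))

  ∣p∣>0⇒nonempty : {p : Subset n} → 0 < ∣ p ∣ → Nonempty p
  ∣p∣>0⇒nonempty {p} 0<∣p∣ with x , x∈p , _ ← outside-member {p} {∅} (subst (_< ∣ p ∣) (sym (∣⊥∣≡0 n)) 0<∣p∣) = x , x∈p

  ⊆∧∣p∣≡∣q∣⇒p≡q : {p q : Subset n} → p ⊆ q → ∣ p ∣ ≡ ∣ q ∣ → p ≡ q
  ⊆∧∣p∣≡∣q∣⇒p≡q {p} {q} p⊆q ∣p∣≡∣q∣ = ⊆-antisym p⊆q q⊆p
    where
    q⊆p : q ⊆ p
    q⊆p {x} x∈q = decidable-stable (x ∈? p) (λ x∉p → <-irrefl ∣p∣≡∣q∣ (p⊂q⇒∣p∣<∣q∣ (p⊆q , x , x∈q , x∉p)))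

module _ {a ℓ} (G : Graph a ℓ) where
  open Graph G

  HasDiameter≤2 : Set (a ⊔ ℓ)
  HasDiameter≤2 = ∀ {u v} → u ≢ v → ¬ Adj u v → ∃ λ w → Adj u w × Adj w v

  Equidistant : V → V → V → Set (a ⊔ ℓ)
  Equidistant x u v = ∃ λ k → Dist G u x k × Dist G v x k

  Separates : V → V → V → Set (a ⊔ ℓ)
  Separates x u v = u ≢ x × v ≢ x × ((Adj u x × ¬ Adj v x) ⊎ (¬ Adj u x × Adj v x))

  AdjacencyAgrees : V → V → V → Set ℓ
  AdjacencyAgrees x u v = (Adj u x × Adj v x) ⊎ (¬ Adj u x × ¬ Adj v x)

  walk≤1⇒≡⊎adjacent : ∀ {u v k} → Walk G u v k → k ≤ 1 → u ≡ v ⊎ Adj u v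
  walk≤1⇒≡⊎adjacent here                _          = inj₁ refl
  walk≤1⇒≡⊎adjacent (step u~v here)     _          = inj₂ u~v
  walk≤1⇒≡⊎adjacent (step _ (step _ _)) (s≤s ())

  dist-one : ∀ {u v} → Adj u v → u ≢ v → Dist G u v 1
  dist-one u~v u≢v = step u~v here , minimal
    where
    minimal : ∀ m → Walk G _ _ m → 1 ≤ m
    minimal zero    here = contradiction refl u≢v
    minimal (suc m) _    = s≤s z≤n

  dist-two : ∀ {u w v} → Adj u w → Adj w v → ¬ Adj u v → u ≢ v → Dist G u v 2
  dist-two u~w w~v u≁v u≢v = step u~w (step w~v here) , minimal
    where
    minimal : ∀ m → Walk G _ _ m → 2 ≤ m
    minimal zero          here            = contradiction refl u≢v
    minimal (suc zero)    (step u~v here) = contradiction u~v u≁v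
    minimal (suc (suc m)) _               = s≤s (s≤s z≤n)

  equidistant-adjacent : ∀ {u v x k} → Adj u x → v ≢ x → Dist G u x k → Dist G v x k → Adj v x
  equidistant-adjacent u~x v≢x (_ , u-minimal) (v⇝x , _)
    with walk≤1⇒≡⊎adjacent v⇝x (u-minimal 1 (step u~x here))
  ... | inj₁ v≡x = contradiction v≡x v≢x
  ... | inj₂ v~x = v~x

  separates⇒≢ : ∀ {x u v} → Separates x u v → u ≢ v
  separates⇒≢ (_ , _ , inj₁ (u~x , v≁x)) refl = v≁x u~x
  separates⇒≢ (_ , _ , inj₂ (u≁x , v~x)) refl = u≁x v~x

  separates⇒¬equidistant : ∀ {x u v} → Separates x u v → ¬ Equidistant x u v
  separates⇒¬equidistant (_   , v≢x , inj₁ (u~x , v≁x)) (_ , du , dv) = v≁x (equidistant-adjacent u~x v≢x du dv)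
  separates⇒¬equidistant (u≢x , _   , inj₂ (u≁x , v~x)) (_ , du , dv) = u≁x (equidistant-adjacent v~x u≢x dv du)

  agrees⇒equidistant : HasDiameter≤2 → ∀ {x u v} → u ≢ x → v ≢ x → AdjacencyAgrees x u v → Equidistant x u v
  agrees⇒equidistant _ u≢x v≢x (inj₁ (u~x , v~x)) = 1 , dist-one u~x u≢x , dist-one v~x v≢x
  agrees⇒equidistant diam u≢x v≢x (inj₂ (u≁x , v≁x))
    with _ , u~w , w~x ← diam u≢x u≁x | _ , v~w′ , w′~x ← diam v≢x v≁x =
    2 , dist-two u~w w~x u≁x u≢x , dist-two v~w′ w′~x v≁x v≢x

  ¬equalizer : ∀ {u v S} → u ≢ v → All (λ x → Separates x u v) S → ¬ IsDistanceEqualizer G S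
  ¬equalizer u≢v seps equalizer
    with x , x∈S , equidistant ← equalizer _ _ u≢v (All¬⇒¬Any (All.map proj₁ seps)) (All¬⇒¬Any (All.map (proj₁ ∘ proj₂) seps))
    = separates⇒¬equidistant (All.lookup seps x∈S) equidistant

  equalizer-if-agreeing : HasDiameter≤2 → ∀ {S} →
    (∀ {u v} → u ∉ S → v ∉ S → ∃ λ x → x ∈ S × AdjacencyAgrees x u v) → IsDistanceEqualizer G S
  equalizer-if-agreeing diam agreeing u v _ u∉S v∉S with x , x∈S , agree ← agreeing u∉S v∉S =
    x , x∈S , agrees⇒equidistant diam (outside x∈S u∉S) (outside x∈S v∉S) agree
    where
    outside : ∀ {x w S} → x ∈ S → w ∉ S → w ≢ x
    outside x∈S w∉S refl = w∉S x∈S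

module _ {n k : ℕ} where
  open Graph (Kneser n k)

  _∈ᵛ_ : Fin n → V → Set
  t ∈ᵛ A = t ∈ˢ proj₁ A

  _∉ᵛ_ : Fin n → V → Set
  t ∉ᵛ A = ¬ t ∈ᵛ A

  vertex-≡ : {A B : V} → proj₁ A ≡ proj₁ B → A ≡ B
  vertex-≡ {_ , ∣A∣≡k} {_ , ∣B∣≡k} refl = cong (_ ,_) (≡-irrelevant ∣A∣≡k ∣B∣≡k)

  ∈∉⇒≢ : ∀ {t} {A B : V} → t ∈ᵛ A → t ∉ᵛ B → A ≢ B
  ∈∉⇒≢ t∈A t∉B refl = t∉B t∈A

  disjoint⇒adjacent : (A B : V) → (∀ {t} → t ∈ᵛ A → t ∈ᵛ B → ⊥) → Adj A B
  disjoint⇒adjacent A B disjoint =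
    Empty-unique λ (t , t∈A∩B) → let t∈A , t∈B = x∈p∩q⁻ (proj₁ A) (proj₁ B) t∈A∩B in disjoint t∈A t∈B

  adjacent⇒disjoint : (A B : V) → Adj A B → ∀ {t} → t ∈ᵛ A → t ∉ᵛ B
  adjacent⇒disjoint _ _ A~B {t} t∈A t∈B = ∉⊥ (subst (t ∈ˢ_) A~B (x∈p∩q⁺ (t∈A , t∈B)))

  shared⇒¬adjacent : (A B : V) → ∀ {t} → t ∈ᵛ A → t ∈ᵛ B → ¬ Adj A B
  shared⇒¬adjacent A B t∈A t∈B A~B = adjacent⇒disjoint A B A~B t∈A t∈B

  adjacent-sym : (A B : V) → Adj A B → Adj B A
  adjacent-sym A B A~B = trans (∩-comm (proj₁ B) (proj₁ A)) A~B

  shared-or-adjacent : (A B : V) → (∃ λ t → t ∈ᵛ A × t ∈ᵛ B) ⊎ Adj A B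
  shared-or-adjacent A B with nonempty? (proj₁ A ∩ proj₁ B)
  ... | yes (t , t∈A∩B) = inj₁ (t , x∈p∩q⁻ (proj₁ A) (proj₁ B) t∈A∩B)
  ... | no empty        = inj₂ (Empty-unique empty)

module _ {n : ℕ} where
  open Graph (Kneser n 2)

  pair : (a b : Fin n) → a ≢ b → V
  pair a b a≢b = ⁅ a ⁆ ∪ ⁅ b ⁆ , ∣⁅x⁆∪⁅y⁆∣≡2 a≢b

  pair-adjacentˡ : ∀ {a b} (a≢b : a ≢ b) (B : V) → a ∉ᵛ B → b ∉ᵛ B → Adj (pair a b a≢b) B
  pair-adjacentˡ a≢b B a∉B b∉B = disjoint⇒adjacent (pair _ _ a≢b) B λ t∈ab t∈B →
    [ (λ { refl → a∉B t∈B }) , (λ { refl → b∉B t∈B }) ] (∈⁅x⁆∪⁅y⁆⁻ t∈ab)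

  ≡pair : ∀ {A : V} {a b} (a≢b : a ≢ b) → a ∈ᵛ A → b ∈ᵛ A → A ≡ pair a b a≢b
  ≡pair {A} {a} {b} a≢b a∈A b∈A =
    sym (vertex-≡ (⊆∧∣p∣≡∣q∣⇒p≡q pair⊆A (trans (∣⁅x⁆∪⁅y⁆∣≡2 a≢b) (sym (proj₂ A)))))
    where
    pair⊆A : ⁅ a ⁆ ∪ ⁅ b ⁆ ⊆ proj₁ A
    pair⊆A t∈ab = [ (λ { refl → a∈A }) , (λ { refl → b∈A }) ] (∈⁅x⁆∪⁅y⁆⁻ t∈ab)

  pair-view-at : (A : V) → ∀ {t} → t ∈ᵛ A → ∃ λ b → Σ (t ≢ b) λ t≢b → A ≡ pair t b t≢b
  pair-view-at A {t} t∈A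
    with b , b∈A , b∉t ← outside-member {p = proj₁ A} {q = ⁅ t ⁆} (subst₂ _<_ (sym (∣⁅x⁆∣≡1 t)) (sym (proj₂ A)) ≤-refl)
    = b , t≢b , ≡pair t≢b t∈A b∈A
    where
    t≢b : t ≢ b
    t≢b = ≢-sym (x∉⁅y⁆⇒x≢y b∉t)

  member : (A : V) → ∃ λ a → a ∈ᵛ A
  member A = ∣p∣>0⇒nonempty (subst (0 <_) (sym (proj₂ A)) (s≤s z≤n))

  pair-view : (A : V) → ∃₂ λ a b → Σ (a ≢ b) λ a≢b → A ≡ pair a b a≢b
  pair-view A = map₂ (pair-view-at A) (member A)

  avoiding-vertex : (l : List (Fin n)) → 2 + length l ≤ n → ∃ λ W → All (_∉ᵛ W) l
  avoiding-vertex l 2+l≤n with fresh l (≤-trans (n≤1+n _) 2+l≤n)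
  ... | e , e∉l with fresh (e ∷ l) 2+l≤n
  ... | e′ , e′≢e ∷ e′∉l =
    pair e e′ (≢-sym e′≢e) , All.zipWith (λ (e≢t , e′≢t) → ∉⁅x⁆∪⁅y⁆ (≢-sym e≢t) (≢-sym e′≢t)) (e∉l , e′∉l)

  adjacent⇒≢ : {A B : V} → Adj A B → A ≢ B
  adjacent⇒≢ {A} A~A refl = adjacent⇒disjoint A A A~A (proj₂ (member A)) (proj₂ (member A))

module Triangle {n : ℕ} (3≤n : 3 ≤ n) where
  open Graph (Kneser n 2)

  corner : Fin 3 → Fin n
  corner i = inject≤ i 3≤n

  corner-≢ : ∀ {i j} → i ≢ j → corner i ≢ corner j
  corner-≢ i≢j = i≢j ∘ inject≤-injective _ _ _ _

  side : Fin 3 → V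
  side 0F = pair (corner 1F) (corner 2F) (corner-≢ λ ())
  side 1F = pair (corner 0F) (corner 2F) (corner-≢ λ ())
  side 2F = pair (corner 0F) (corner 1F) (corner-≢ λ ())

  ∈-side⁺ : ∀ {i} k → i ≢ k → corner i ∈ᵛ side k
  ∈-side⁺ {0F} 0F 0≢0 = contradiction refl 0≢0
  ∈-side⁺ {1F} 0F _   = x∈⁅x⁆∪⁅y⁆
  ∈-side⁺ {2F} 0F _   = y∈⁅x⁆∪⁅y⁆
  ∈-side⁺ {0F} 1F _   = x∈⁅x⁆∪⁅y⁆
  ∈-side⁺ {1F} 1F 1≢1 = contradiction refl 1≢1
  ∈-side⁺ {2F} 1F _   = y∈⁅x⁆∪⁅y⁆
  ∈-side⁺ {0F} 2F _   = x∈⁅x⁆∪⁅y⁆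
  ∈-side⁺ {1F} 2F _   = y∈⁅x⁆∪⁅y⁆
  ∈-side⁺ {2F} 2F 2≢2 = contradiction refl 2≢2

  ∈-side⁻ : ∀ {t} k → t ∈ᵛ side k → ∃ λ j → j ≢ k × t ≡ corner j
  ∈-side⁻ 0F t∈side = [ (λ t≡ → 1F , (λ ()) , t≡) , (λ t≡ → 2F , (λ ()) , t≡) ] (∈⁅x⁆∪⁅y⁆⁻ t∈side)
  ∈-side⁻ 1F t∈side = [ (λ t≡ → 0F , (λ ()) , t≡) , (λ t≡ → 2F , (λ ()) , t≡) ] (∈⁅x⁆∪⁅y⁆⁻ t∈side)
  ∈-side⁻ 2F t∈side = [ (λ t≡ → 0F , (λ ()) , t≡) , (λ t≡ → 1F , (λ ()) , t≡) ] (∈⁅x⁆∪⁅y⁆⁻ t∈side)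

  corner∉side : ∀ k → corner k ∉ᵛ side k
  corner∉side k ck∈side with j , j≢k , ck≡cj ← ∈-side⁻ k ck∈side = corner-≢ (≢-sym j≢k) ck≡cj

  side-injective : ∀ {i j} → side i ≡ side j → i ≡ j
  side-injective {i} {j} si≡sj with i ≟ j
  ... | yes i≡j = i≡j
  ... | no i≢j  = contradiction (subst (corner i ∈ᵛ_) (sym si≡sj) (∈-side⁺ j i≢j)) (corner∉side i)

  side-adjacent : (u : V) (k : Fin 3) → (∀ j → j ≢ k → corner j ∉ᵛ u) → Adj u (side k)
  side-adjacent u k only = disjoint⇒adjacent u (side k) λ t∈u t∈side →
    let j , j≢k , t≡cj = ∈-side⁻ k t∈side in only j j≢k (subst (_∈ᵛ u) t≡cj t∈u)

  sides : List V
  sides = tabulate side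

  side∈sides : ∀ k → side k ∈ sides
  side∈sides k = Any.tabulate⁺ {f = side} k refl

  data CornerTrace (u : V) : Set where
    no-corner  : (∀ j → corner j ∉ᵛ u) → CornerTrace u
    one-corner : ∀ i → corner i ∈ᵛ u → (∀ j → j ≢ i → corner j ∉ᵛ u) → CornerTrace u

  corner-trace : ∀ {u} → u ∉ sides → CornerTrace u
  corner-trace {u} u∉sides with any? (λ i → corner i ∈? proj₁ u)
  ... | no ∄          = no-corner (λ j cj∈u → ∄ (j , cj∈u))
  ... | yes (i , ci∈u) = one-corner i ci∈u only
    where
    only : ∀ j → j ≢ i → corner j ∉ᵛ u
    only j j≢i cj∈u with k , k≢j ∷ k≢i ∷ [] ← fresh (j ∷ i ∷ []) ≤-refl =
      u∉sides (subst (_∈ sides) (sym u≡side) (side∈sides k))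
      where
      cj≢ci = corner-≢ j≢i
      u≡side : u ≡ side k
      u≡side = trans (≡pair cj≢ci cj∈u ci∈u) (sym (≡pair cj≢ci (∈-side⁺ k (≢-sym k≢j)) (∈-side⁺ k (≢-sym k≢i))))

  agreeing-side : ∀ {u v} → CornerTrace u → CornerTrace v → ∃ λ k → AdjacencyAgrees (Kneser n 2) (side k) u v
  agreeing-side {u} {v} (no-corner ∉u) (no-corner ∉v) =
    0F , inj₁ (side-adjacent u 0F (λ j _ → ∉u j) , side-adjacent v 0F (λ j _ → ∉v j))
  agreeing-side {u} {v} (no-corner ∉u) (one-corner i _ onlyᵥ) =
    i , inj₁ (side-adjacent u i (λ j _ → ∉u j) , side-adjacent v i onlyᵥ)
  agreeing-side {u} {v} (one-corner i _ onlyᵤ) (no-corner ∉v) =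
    i , inj₁ (side-adjacent u i onlyᵤ , side-adjacent v i (λ j _ → ∉v j))
  agreeing-side {u} {v} (one-corner i ci∈u onlyᵤ) (one-corner j cj∈v onlyᵥ) with i ≟ j
  ... | yes refl = i , inj₁ (side-adjacent u i onlyᵤ , side-adjacent v i onlyᵥ)
  ... | no i≢j with k , k≢i ∷ k≢j ∷ [] ← fresh (i ∷ j ∷ []) ≤-refl =
    k , inj₂ ( shared⇒¬adjacent u (side k) ci∈u (∈-side⁺ k (≢-sym k≢i))
             , shared⇒¬adjacent v (side k) cj∈v (∈-side⁺ k (≢-sym k≢j)))

  sides-equalizer : HasDiameter≤2 (Kneser n 2) → IsDistanceEqualizer (Kneser n 2) sides
  sides-equalizer diam = equalizer-if-agreeing (Kneser n 2) diam agreeing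
    where
    agreeing : ∀ {u v} → u ∉ sides → v ∉ sides → ∃ λ x → x ∈ sides × AdjacencyAgrees (Kneser n 2) x u v
    agreeing u∉ v∉ with k , agree ← agreeing-side (corner-trace u∉) (corner-trace v∉) = side k , side∈sides k , agree

  sides-unique : Unique sides
  sides-unique = Unique.tabulate⁺ side-injective

module _ {n : ℕ} (5≤n : 5 ≤ n) where
  open Graph (Kneser n 2)

  common-neighbour : (A B : V) → ∀ {t} → t ∈ᵛ A → t ∈ᵛ B → ∃ λ W → Adj A W × Adj W B
  common-neighbour A B {t} t∈A t∈B with pair-view-at A t∈A | pair-view-at B t∈B
  ... | b , t≢b , refl | d , t≢d , refl with avoiding-vertex (t ∷ b ∷ d ∷ []) 5≤n
  ... | W , t∉W ∷ b∉W ∷ d∉W ∷ [] =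
    W , pair-adjacentˡ t≢b W t∉W b∉W , adjacent-sym (pair t d t≢d) W (pair-adjacentˡ t≢d W t∉W d∉W)

  kneser-diameter≤2 : HasDiameter≤2 (Kneser n 2)
  kneser-diameter≤2 {u} {v} _ u≁v with shared-or-adjacent u v
  ... | inj₁ (_ , t∈u , t∈v) = common-neighbour u v t∈u t∈v
  ... | inj₂ u~v             = contradiction u~v u≁v

  SeparatedPair : V → V → Set
  SeparatedPair x y = ∃₂ λ u v → All (λ z → Separates (Kneser n 2) z u v) (x ∷ y ∷ [])

  separated-pair-sharing : ∀ {x y : V} {t} → t ∈ᵛ x → t ∈ᵛ y → SeparatedPair x y
  separated-pair-sharing {x} {y} {t} t∈x t∈y with common-neighbour x y t∈x t∈y
  ... | W , x~W , W~y with member W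
  ... | e , e∈W = u , W , x-separates ∷ y-separates ∷ []
    where
    W~x = adjacent-sym x W x~W
    e∉x = adjacent⇒disjoint W x W~x e∈W
    e∉y = adjacent⇒disjoint W y W~y e∈W
    t≢e : t ≢ e
    t≢e refl = e∉x t∈x
    u = pair t e t≢e
    x-separates : Separates (Kneser n 2) x u W
    x-separates = ∈∉⇒≢ y∈⁅x⁆∪⁅y⁆ e∉x , adjacent⇒≢ W~x , inj₂ (shared⇒¬adjacent u x x∈⁅x⁆∪⁅y⁆ t∈x , W~x)
    y-separates : Separates (Kneser n 2) y u W
    y-separates = ∈∉⇒≢ y∈⁅x⁆∪⁅y⁆ e∉y , adjacent⇒≢ W~y , inj₂ (shared⇒¬adjacent u y x∈⁅x⁆∪⁅y⁆ t∈y , W~y)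

  separated-pair-adjacent : ∀ {x y : V} → Adj x y → SeparatedPair x y
  separated-pair-adjacent {x} {y} x~y with pair-view x | pair-view y
  ... | a , b , _ , refl | c , d , _ , refl with fresh (a ∷ b ∷ c ∷ d ∷ []) 5≤n
  ... | e , e≢a ∷ e≢b ∷ e≢c ∷ e≢d ∷ [] = u , v , x-separates ∷ y-separates ∷ []
    where
    u = pair a e (≢-sym e≢a)
    v = pair c e (≢-sym e≢c)
    e∉x = ∉⁅x⁆∪⁅y⁆ e≢a e≢b
    e∉y = ∉⁅x⁆∪⁅y⁆ e≢c e≢d
    u~y = pair-adjacentˡ (≢-sym e≢a) y (adjacent⇒disjoint x y x~y x∈⁅x⁆∪⁅y⁆) e∉y
    v~x = pair-adjacentˡ (≢-sym e≢c) x (adjacent⇒disjoint y x (adjacent-sym x y x~y) x∈⁅x⁆∪⁅y⁆) e∉x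
    x-separates : Separates (Kneser n 2) x u v
    x-separates = ∈∉⇒≢ y∈⁅x⁆∪⁅y⁆ e∉x , adjacent⇒≢ v~x , inj₂ (shared⇒¬adjacent u x x∈⁅x⁆∪⁅y⁆ x∈⁅x⁆∪⁅y⁆ , v~x)
    y-separates : Separates (Kneser n 2) y u v
    y-separates = adjacent⇒≢ u~y , ∈∉⇒≢ y∈⁅x⁆∪⁅y⁆ e∉y , inj₁ (u~y , shared⇒¬adjacent v y x∈⁅x⁆∪⁅y⁆ x∈⁅x⁆∪⁅y⁆)

  separated-pair : (x y : V) → SeparatedPair x y
  separated-pair x y with shared-or-adjacent x y
  ... | inj₁ (_ , t∈x , t∈y) = separated-pair-sharing t∈x t∈y
  ... | inj₂ x~y             = separated-pair-adjacent x~y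

  ¬equalizer-within-two : ∀ {x y S} → S ⊆ˡ x ∷ y ∷ [] → ¬ IsDistanceEqualizer (Kneser n 2) S
  ¬equalizer-within-two {x} {y} S⊆xy with u , v , seps ← separated-pair x y =
    ¬equalizer (Kneser n 2) (separates⇒≢ (Kneser n 2) (All.head seps)) (anti-mono S⊆xy seps)

  equalizer-length : ∀ {S} → IsDistanceEqualizer (Kneser n 2) S → 3 ≤ length S
  equalizer-length {[]}              = ⊥-elim ∘ ¬equalizer-within-two {x = x₀} {x₀} λ ()
    where x₀ = Triangle.side (≤-trans (m≤m+n 3 2) 5≤n) 0F
  equalizer-length {x ∷ []}          = ⊥-elim ∘ ¬equalizer-within-two {x = x} {x} λ { (here x≡) → here x≡ }
  equalizer-length {x ∷ y ∷ []}      = ⊥-elim ∘ ¬equalizer-within-two {x = x} {y} id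
  equalizer-length {_ ∷ _ ∷ _ ∷ _} _ = s≤s (s≤s (s≤s z≤n))

theorem6 : ∀ (n : ℕ) → 5 ≤ n → EqDim≡ (Kneser n 2) 3
theorem6 n 5≤n =
  (sides , sides-unique , refl , sides-equalizer (kneser-diameter≤2 5≤n)) , λ _ _ → equalizer-length 5≤n
  where open Triangle (≤-trans (m≤m+n 3 2) 5≤n)
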